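{- Let $k\ge 2$ and let $\lambda$ be a partition with $|\lambda|=kp$. If $\mathrm{RHT}^\lambda_{k\mu}\neq\emptyset$ for some weak composition $\mu$ with $|\mu|=p$, then $\mathrm{RHT}^\lambda_{k\mu}\neq\emptyset$ also for $\mu=(1^p)$, i.e. $\mathrm{RHT}^\lambda_{(k^p)}\neq\emptyset$.
   Context: A weak composition is a sequence $\mu=(\mu_1,\mu_2,\ldots)$ of nonnegative integers with finite sum $|\mu|$; $k\mu:=(k\mu_1,k\mu_2,\ldots)$. A rim hook is a connected skew shape containing no $2\times2$ square. For a weak composition $\nu$ with $|\nu|=|\lambda|$ and $\nu_j=0$ for $j>r$, $\mathrm{RHT}^\lambda_\nu$ is the set of chains of partitions $\emptyset=\lambda^0\subseteq\cdots\subseteq\lambda^r=\lambda$ such that each $\lambda^j/\lambda^{j-1}$ is a rim hook with $\nu_j$ boxes (empty if $\nu_j=0$). -}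

module Defs where

open import Data.Nat using (ℕ; zero; suc; _+_; _*_; _≤_; _<_; _≥_)
open import Data.List using (List; []; _∷_; map; replicate)
open import Data.Nat.ListAction using (sum)
open import Data.List.Relation.Unary.All using (All)
open import Data.List.Relation.Unary.Linked using (Linked)
open import Data.Product using (_×_; Σ)
open import Data.Sum using (_⊎_)
open import Relation.Binary.PropositionalEquality using (_≡_)
open import Relation.Nullary using (¬_)

IsPartition : List ℕ → Set
IsPartition λ′ = All (λ x → 1 ≤ x) λ′ × Linked _≥_ λ′

-- i-th part (0-indexed), 0 beyond the length.
part : List ℕ → ℕ → ℕ
part []       _       = 0
part (x ∷ _)  zero    = x
part (_ ∷ xs) (suc i) = part xs i

size : List ℕ → ℕ
size = sum

_⊆ᵖ_ : List ℕ → List ℕ → Set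
α ⊆ᵖ β = ∀ i → part α i ≤ part β i

-- Cells are (row , column), 0-indexed.
Cell : Set
Cell = ℕ × ℕ

InSkew : List ℕ → List ℕ → Cell → Set
InSkew β α (i Data.Product., j) = part α i ≤ j × j < part β i

Adjacent : Cell → Cell → Set
Adjacent (i Data.Product., j) (i′ Data.Product., j′) =
  (i ≡ i′ × (suc j ≡ j′ ⊎ j ≡ suc j′)) ⊎ (j ≡ j′ × (suc i ≡ i′ ⊎ i ≡ suc i′))

data Path (S : Cell → Set) : Cell → Cell → Set where
  here  : ∀ {c} → Path S c c
  step  : ∀ {c d e} → S d → Adjacent c d → Path S d e → Path S c e

ConnectedSkew : List ℕ → List ℕ → Set
ConnectedSkew β α = ∀ c d → InSkew β α c → InSkew β α d → Path (InSkew β α) c d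

No2x2 : List ℕ → List ℕ → Set
No2x2 β α = ∀ i j → ¬ (InSkew β α (i Data.Product., j)
                      × InSkew β α (i Data.Product., suc j)
                      × InSkew β α (suc i Data.Product., j)
                      × InSkew β α (suc i Data.Product., suc j))

-- β / α is a rim hook with n boxes (the empty skew shape when n = 0)
RimHook : List ℕ → List ℕ → ℕ → Set
RimHook β α n = α ⊆ᵖ β × size β ≡ size α + n × ConnectedSkew β α × No2x2 β α

data Chain : List ℕ → List ℕ → List ℕ → Set where
  done : ∀ {α} → Chain α [] α
  add  : ∀ {α β γ n ν} → IsPartition β → RimHook β α n → Chain β ν γ →
         Chain α (n ∷ ν) γ

RHT : List ℕ → List ℕ → Set
RHT λ′ ν = Chain [] ν λ′

scale : ℕ → List ℕ → List ℕ
scale k μ = map (k *_) μ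

{-# OPTIONS --safe #-}

-- A partition with at most M rows is encoded by its M bead positions λᵢ + M − 1 − i (its
-- abacus, or Maya diagram). Adding a rim hook of size n moves one bead from an occupied
-- position y to the free position y + n, and conversely every such move adds a rim hook.
-- A move y ↦ y + n₁ + n₂ therefore factors into moves by n₁ and n₂: through y + n₁ if that
-- position is free, and otherwise by first moving the bead at y + n₁ to y + n₁ + n₂ and then
-- the bead at y to y + n₁. So a rim hook of size k m is a chain of m rim hooks of size k, and
-- a chain of type k μ refines to one of type (k, …, k).

module Submission where

open import Defs
open import Data.Nat.ListAction using (sum)
open import Data.Nat using (ℕ; zero; suc; _+_; _*_; _∸_; _≤_; _<_; _≥_; _>_; z≤n; s≤s; _≟_; _≤?_)
open import Data.Nat.Properties
open import Relation.Binary.Definitions using (tri<; tri≈; tri>)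
open import Data.List.Properties using (∷-injectiveˡ; ∷-injectiveʳ)
open import Data.List using (List; []; _∷_; length; drop; replicate; _++_)
import Data.List.Relation.Unary.All as All
open All using (All; []; _∷_) renaming (map to All-map; lookup to All-lookup)
open import Data.List.Relation.Unary.AllPairs using (AllPairs; []; _∷_)
open import Data.List.Relation.Unary.Any using (here; there) renaming (tail to Any-tail)
open import Data.List.Relation.Unary.Linked using (Linked; []; [-]; _∷_)
open import Data.List.Membership.Propositional using (_∈_; _∉_)
open import Data.List.Membership.DecPropositional _≟_ using (_∈?_)
open import Data.List.Relation.Binary.Subset.Propositional using (_⊆_)
open import Data.Product using (∃; _×_; _,_; proj₁; proj₂) renaming (map₁ to ×-map₁)
open import Data.Sum using (_⊎_; inj₁; inj₂; [_,_]′) renaming (map₂ to ⊎-map₂)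
open import Data.Empty using (⊥-elim)
open import Function using (_∘_; case_of_; _⇔_; mk⇔; Equivalence)
open Equivalence using (to; from)
open import Relation.Nullary using (yes; no)
open import Relation.Binary.PropositionalEquality
open import Data.Nat.Tactic.RingSolver using (solve-∀)

Positive : List ℕ → Set
Positive = All (1 ≤_)

Decreasing : List ℕ → Set
Decreasing l = ∀ i → part l (suc i) ≤ part l i

Linked⇒Decreasing : ∀ {l} → Linked _≥_ l → Decreasing l
Linked⇒Decreasing []       _       = z≤n
Linked⇒Decreasing [-]      _       = z≤n
Linked⇒Decreasing (r ∷ _)  zero    = r
Linked⇒Decreasing (_ ∷ rs) (suc i) = Linked⇒Decreasing rs i

Decreasing⇒Linked : ∀ l → Decreasing l → Linked _≥_ l
Decreasing⇒Linked []           _ = []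
Decreasing⇒Linked (_ ∷ [])     _ = [-]
Decreasing⇒Linked (_ ∷ y ∷ ys) d = d 0 ∷ Decreasing⇒Linked (y ∷ ys) (d ∘ suc)

IsPartition⇒Decreasing : ∀ {l} → IsPartition l → Decreasing l
IsPartition⇒Decreasing = Linked⇒Decreasing ∘ proj₂

part-suc : ∀ l i → part l (suc i) ≡ part (drop 1 l) i
part-suc []      _ = refl
part-suc (_ ∷ _) _ = refl

size-drop : ∀ l → size l ≡ part l 0 + size (drop 1 l)
size-drop []      = refl
size-drop (_ ∷ _) = refl

Decreasing-drop : ∀ l → Decreasing l → Decreasing (drop 1 l)
Decreasing-drop []      d = d
Decreasing-drop (_ ∷ _) d = d ∘ suc

part-1≤part-0 : ∀ l → Decreasing l → part (drop 1 l) 0 ≤ part l 0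
part-1≤part-0 l d = subst (_≤ part l 0) (part-suc l 0) (d 0)

Positive-drop : ∀ {l} → Positive l → Positive (drop 1 l)
Positive-drop []      = []
Positive-drop (_ ∷ p) = p

length-drop : ∀ (l : List ℕ) {M} → length l ≤ suc M → length (drop 1 l) ≤ M
length-drop []      _          = z≤n
length-drop (_ ∷ _) (s≤s l≤M) = l≤M

⊆ᵖ-drop : ∀ a b → a ⊆ᵖ b → drop 1 a ⊆ᵖ drop 1 b
⊆ᵖ-drop a b a⊆b i = subst₂ _≤_ (part-suc a i) (part-suc b i) (a⊆b (suc i))

part-ext : ∀ {a b} → Positive a → Positive b → (∀ i → part a i ≡ part b i) → a ≡ b
part-ext []       []       _ = refl
part-ext []       (p ∷ _)  e with () ← subst (1 ≤_) (sym (e 0)) p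
part-ext (p ∷ _)  []       e with () ← subst (1 ≤_) (e 0) p
part-ext (_ ∷ pa) (_ ∷ pb) e = cong₂ _∷_ (e 0) (part-ext pa pb (e ∘ suc))

length≤size : ∀ {l} → Positive l → length l ≤ size l
length≤size []       = z≤n
length≤size (p ∷ ps) = +-mono-≤ p (length≤size ps)

size-mono : ∀ a b → a ⊆ᵖ b → size a ≤ size b
size-mono []      _ _   = z≤n
size-mono (x ∷ a) b a⊆b = subst (x + size a ≤_) (sym (size-drop b))
  (+-mono-≤ (a⊆b 0) (size-mono a (drop 1 b) (⊆ᵖ-drop (x ∷ a) b a⊆b)))

-- The abacus of a partition

beads : ℕ → List ℕ → List ℕ
beads zero    _ = []
beads (suc M) l = part l 0 + M ∷ beads M (drop 1 l)

beads-< : ∀ M l {c} → Decreasing l → part l 0 ≤ c → All (_< c + M) (beads M l)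
beads-< zero    _ _ _ = []
beads-< (suc M) l {c} d l₀≤c =
  ≤-<-trans (+-monoˡ-≤ M l₀≤c) c+M<c+1+M
  ∷ All-map (λ x<c+M → <-trans x<c+M c+M<c+1+M)
            (beads-< M (drop 1 l) (Decreasing-drop l d) (≤-trans (part-1≤part-0 l d) l₀≤c))
  where
  c+M<c+1+M : c + M < c + suc M
  c+M<c+1+M = +-monoʳ-< c (n<1+n M)

∈-beads-< : ∀ {M} l {x} → Decreasing l → x ∈ beads M l → x < part l 0 + M
∈-beads-< {M} l d = All-lookup (beads-< M l d ≤-refl)

∈-beads-[] : ∀ {M x} → x < M → x ∈ beads M []
∈-beads-[] {suc M} x<1+M with m≤n⇒m<n∨m≡n (≤-pred x<1+M)
... | inj₁ x<M = there (∈-beads-[] x<M)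
... | inj₂ x≡M = here x≡M

beads-descending : ∀ M l → Decreasing l → AllPairs _>_ (beads M l)
beads-descending zero    _ _ = []
beads-descending (suc M) l d =
  beads-< M (drop 1 l) (Decreasing-drop l d) (part-1≤part-0 l d)
  ∷ beads-descending M (drop 1 l) (Decreasing-drop l d)

descending-⊆-antisym : ∀ {xs ys} → AllPairs _>_ xs → AllPairs _>_ ys → xs ⊆ ys → ys ⊆ xs → xs ≡ ys
descending-⊆-antisym {[]}    {[]}    _ _ _ _ = refl
descending-⊆-antisym {[]}    {_ ∷ _} _ _ _ ys⊆xs with () ← ys⊆xs (here refl)
descending-⊆-antisym {_ ∷ _} {[]}    _ _ xs⊆ys _ with () ← xs⊆ys (here refl)
descending-⊆-antisym {x ∷ xs} {y ∷ ys} (x> ∷ dxs) (y> ∷ dys) xs⊆ys ys⊆xs =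
  cong₂ _∷_ x≡y (descending-⊆-antisym dxs dys
    (λ z∈xs → Any-tail (λ z≡y → <-irrefl (trans z≡y (sym x≡y)) (All-lookup x> z∈xs))
                       (xs⊆ys (there z∈xs)))
    (λ z∈ys → Any-tail (λ z≡x → <-irrefl (trans z≡x x≡y) (All-lookup y> z∈ys))
                       (ys⊆xs (there z∈ys))))
  where
  x≡y : x ≡ y
  x≡y with xs⊆ys (here refl) | ys⊆xs (here refl)
  ... | here x≡y   | _          = x≡y
  ... | there _    | here y≡x   = sym y≡x
  ... | there x∈ys | there y∈xs = ⊥-elim (<-asym (All-lookup y> x∈ys) (All-lookup x> y∈xs))

beads-injective : ∀ M {a b} → Positive a → Positive b → length a ≤ M → length b ≤ M →
                  beads M a ≡ beads M b → a ≡ b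
beads-injective zero {[]}    {[]}    _ _ _  _  _ = refl
beads-injective zero {_ ∷ _} {_}     _ _ () _  _
beads-injective zero {[]}    {_ ∷ _} _ _ _  () _
beads-injective (suc M) {a} {b} pa pb la lb e = part-ext pa pb parts≡
  where
  drop≡ : drop 1 a ≡ drop 1 b
  drop≡ = beads-injective M (Positive-drop pa) (Positive-drop pb)
            (length-drop a la) (length-drop b lb) (∷-injectiveʳ e)
  parts≡ : ∀ i → part a i ≡ part b i
  parts≡ zero    = +-cancelʳ-≡ M _ _ (∷-injectiveˡ e)
  parts≡ (suc i) = begin
    part a (suc i)        ≡⟨ part-suc a i ⟩
    part (drop 1 a) i     ≡⟨ cong (λ l → part l i) drop≡ ⟩
    part (drop 1 b) i     ≡⟨ part-suc b i ⟨
    part b (suc i)        ∎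
    where open ≡-Reasoning

beads-⊆-antisym : ∀ M {a b} → IsPartition a → IsPartition b → length a ≤ M → length b ≤ M →
                  beads M a ⊆ beads M b → beads M b ⊆ beads M a → a ≡ b
beads-⊆-antisym M {a} {b} pa pb la lb a⊆b b⊆a =
  beads-injective M (proj₁ pa) (proj₁ pb) la lb
    (descending-⊆-antisym (beads-descending M a (IsPartition⇒Decreasing pa))
                  (beads-descending M b (IsPartition⇒Decreasing pb)) a⊆b b⊆a)

-- Moving beads

Removed : ℕ → List ℕ → List ℕ → Set
Removed y xs ys = ∀ {x} → x ∈ ys ⇔ (x ∈ xs × x ≢ y)

Moved : ℕ → ℕ → List ℕ → List ℕ → Set
Moved y z xs ys = ∀ {x} → x ∈ ys ⇔ (x ≡ z ⊎ x ∈ xs × x ≢ y)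

removed-head : ∀ {z xs} → z ∉ xs → Removed z (z ∷ xs) xs
removed-head z∉xs = mk⇔ (λ x∈xs → there x∈xs , λ { refl → z∉xs x∈xs })
                        λ { (here x≡z , x≢z) → ⊥-elim (x≢z x≡z) ; (there x∈xs , _) → x∈xs }

removed-∷ : ∀ {h y xs ys} → h ≢ y → Removed y xs ys → Removed y (h ∷ xs) (h ∷ ys)
removed-∷ h≢y r = mk⇔
  (λ { (here refl) → here refl , h≢y
     ; (there x∈ys) → let x∈xs , x≢y = to r x∈ys in there x∈xs , x≢y })
  (λ { (here refl , _) → here refl
     ; (there x∈xs , x≢y) → there (from r (x∈xs , x≢y)) })

removed⇒moved : ∀ {y z xs ys} → Removed y xs ys → Moved y z xs (z ∷ ys)
removed⇒moved r = mk⇔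
  (λ { (here x≡z) → inj₁ x≡z ; (there x∈ys) → inj₂ (to r x∈ys) })
  (λ { (inj₁ x≡z) → here x≡z ; (inj₂ x∈xs-y) → there (from r x∈xs-y) })

moved-∷ : ∀ {h y z xs ys} → h ≢ y → Moved y z xs ys → Moved y z (h ∷ xs) (h ∷ ys)
moved-∷ h≢y m = mk⇔
  (λ { (here refl) → inj₂ (here refl , h≢y)
     ; (there x∈ys) → ⊎-map₂ (×-map₁ there) (to m x∈ys) })
  (λ { (inj₁ x≡z) → there (from m (inj₁ x≡z))
     ; (inj₂ (here refl , _)) → here refl
     ; (inj₂ (there x∈xs , x≢y)) → there (from m (inj₂ (x∈xs , x≢y))) })

moved-target : ∀ {y z xs ys} → Moved y z xs ys → z ∈ ys
moved-target m = from m (inj₁ refl)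

moved-source : ∀ {y z xs ys} → y ≢ z → Moved y z xs ys → y ∉ ys
moved-source y≢z m y∈ys with to m y∈ys
... | inj₁ y≡z       = y≢z y≡z
... | inj₂ (_ , y≢y) = y≢y refl

moved-∈ : ∀ {x y z xs ys} → Moved y z xs ys → x ∈ xs → x ≢ y → x ∈ ys
moved-∈ m x∈xs x≢y = from m (inj₂ (x∈xs , x≢y))

moved-∉ : ∀ {x y z xs ys} → Moved y z xs ys → x ∉ xs → x ≢ z → x ∉ ys
moved-∉ m x∉xs x≢z x∈ys with to m x∈ys
... | inj₁ x≡z        = x≢z x≡z
... | inj₂ (x∈xs , _) = x∉xs x∈xs

moved-⊆ : ∀ {y z xs ys ys′} → Moved y z xs ys → Moved y z xs ys′ → ys ⊆ ys′
moved-⊆ m m′ = from m′ ∘ to m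

moved-trans : ∀ {y z w xs ys zs} → z ∉ xs → Moved y z xs ys → Moved z w ys zs → Moved y w xs zs
moved-trans z∉xs m₁ m₂ = mk⇔
  (λ x∈zs → case to m₂ x∈zs of λ
     { (inj₁ x≡w) → inj₁ x≡w
     ; (inj₂ (x∈ys , x≢z)) → case to m₁ x∈ys of λ
         { (inj₁ x≡z) → ⊥-elim (x≢z x≡z)
         ; (inj₂ x∈xs-y) → inj₂ x∈xs-y } })
  (λ { (inj₁ x≡w) → from m₂ (inj₁ x≡w)
     ; (inj₂ (x∈xs , x≢y)) →
         from m₂ (inj₂ (moved-∈ m₁ x∈xs x≢y , λ { refl → z∉xs x∈xs })) })

moved-swap : ∀ {y z w xs ys zs} → z ∈ xs → z ≢ y → w ≢ y →
             Moved z w xs ys → Moved y z ys zs → Moved y w xs zs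
moved-swap {z = z} z∈xs z≢y w≢y m₁ m₂ {x} = mk⇔
  (λ x∈zs → case to m₂ x∈zs of λ
     { (inj₁ refl) → inj₂ (z∈xs , z≢y)
     ; (inj₂ (x∈ys , x≢y)) → case to m₁ x∈ys of λ
         { (inj₁ x≡w) → inj₁ x≡w
         ; (inj₂ (x∈xs , _)) → inj₂ (x∈xs , x≢y) } })
  (λ { (inj₁ refl) → from m₂ (inj₂ (moved-target m₁ , w≢y))
     ; (inj₂ (x∈xs , x≢y)) → case x ≟ z of λ
         { (yes x≡z) → from m₂ (inj₁ x≡z)
         ; (no x≢z) → from m₂ (inj₂ (moved-∈ m₁ x∈xs x≢z , x≢y)) } })

-- Rim hooks in terms of row lengths

-- For decreasing a ⊆ b, rows l and l + 1 of b/a share exactly the columns aₗ ≤ c < bₗ₊₁. So b/a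
-- has no 2×2 square iff Overlap≤1 b a, and it is connected iff LinkedRows b a.
Overlap≤1 : List ℕ → List ℕ → Set
Overlap≤1 b a = ∀ i → part b (suc i) ≤ suc (part a i)

LinkedRows : List ℕ → List ℕ → Set
LinkedRows b a = ∀ {i j} l → part a i < part b i → part a j < part b j → i ≤ l → l < j →
                 part a l < part b (suc l)

LinkedToTop : List ℕ → List ℕ → Set
LinkedToTop b a = ∀ {j} l → part a j < part b j → l < j → part a l < part b (suc l)

Ribbon : List ℕ → List ℕ → Set
Ribbon b a = a ⊆ᵖ b × Overlap≤1 b a × LinkedRows b a

No2x2⇒Overlap≤1 : ∀ {a b} → Decreasing a → Decreasing b → No2x2 b a → Overlap≤1 b a
No2x2⇒Overlap≤1 {a} {b} da db no2x2 i with part b (suc i) ≤? suc (part a i)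
... | yes ok = ok
... | no too-long = ⊥-elim (no2x2 i (part a i)
        ( (≤-refl , ≤-trans (≤-trans (n≤1+n _) 2+aᵢ≤b₁₊ᵢ) (db i))
        , (n≤1+n _ , ≤-trans 2+aᵢ≤b₁₊ᵢ (db i))
        , (da i , ≤-trans (n≤1+n _) 2+aᵢ≤b₁₊ᵢ)
        , (≤-trans (da i) (n≤1+n _) , 2+aᵢ≤b₁₊ᵢ) ))
  where
  2+aᵢ≤b₁₊ᵢ : suc (suc (part a i)) ≤ part b (suc i)
  2+aᵢ≤b₁₊ᵢ = ≰⇒> too-long

Overlap≤1⇒No2x2 : ∀ {a b} → Overlap≤1 b a → No2x2 b a
Overlap≤1⇒No2x2 thin i j ((aᵢ≤j , _) , _ , _ , (_ , 1+j<b₁₊ᵢ)) =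
  <-irrefl refl (≤-trans 1+j<b₁₊ᵢ (≤-trans (thin i) (s≤s aᵢ≤j)))

Adjacent-sym : ∀ {c d} → Adjacent c d → Adjacent d c
Adjacent-sym (inj₁ (refl , inj₁ refl)) = inj₁ (refl , inj₂ refl)
Adjacent-sym (inj₁ (refl , inj₂ refl)) = inj₁ (refl , inj₁ refl)
Adjacent-sym (inj₂ (refl , inj₁ refl)) = inj₂ (refl , inj₂ refl)
Adjacent-sym (inj₂ (refl , inj₂ refl)) = inj₂ (refl , inj₁ refl)

module _ {S : Cell → Set} where

  Path-snoc : ∀ {c d e} → Path S c d → S e → Adjacent d e → Path S c e
  Path-snoc here           se d~e = step se d~e here
  Path-snoc (step sd c~d p) se d~e = step sd c~d (Path-snoc p se d~e)

  _++ᵖ_ : ∀ {c d e} → Path S c d → Path S d e → Path S c e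
  here            ++ᵖ q = q
  step sd c~d p   ++ᵖ q = step sd c~d (p ++ᵖ q)

  Path-reverse : ∀ {c d} → S c → Path S c d → Path S d c
  Path-reverse sc here            = here
  Path-reverse sc (step sd c~d p) = Path-snoc (Path-reverse sd p) sc (Adjacent-sym c~d)

  Path-crosses : ∀ {i j i′ j′} l → S (i , j) → Path S (i , j) (i′ , j′) → i ≤ l → l < i′ →
                 ∃ λ c → S (l , c) × S (suc l , c)
  Path-crosses l _ here i≤l l<i = ⊥-elim (<-irrefl refl (≤-<-trans i≤l l<i))
  Path-crosses {i} {j} l sc (step {d = i₂ , _} sd c~d p) i≤l l<i′ with i₂ ≤? l
  ... | yes i₂≤l = Path-crosses l sd p i₂≤l l<i′
  ... | no i₂≰l with c~d
  ...   | inj₁ (refl , _)        = ⊥-elim (i₂≰l i≤l)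
  ...   | inj₂ (refl , inj₂ refl) = ⊥-elim (i₂≰l (≤-trans (n≤1+n i₂) i≤l))
  ...   | inj₂ (refl , inj₁ refl) with refl ← ≤-antisym i≤l (≮⇒≥ i₂≰l) = j , sc , sd

Connected⇒LinkedRows : ∀ {a b} → ConnectedSkew b a → LinkedRows b a
Connected⇒LinkedRows {a} {b} connected {i} {j} l aᵢ<bᵢ aⱼ<bⱼ i≤l l<j
  with c , (aₗ≤c , _) , (_ , c<b₁₊ₗ) ← Path-crosses l (≤-refl , aᵢ<bᵢ)
         (connected (i , part a i) (j , part a j) (≤-refl , aᵢ<bᵢ) (≤-refl , aⱼ<bⱼ)) i≤l l<j
  = ≤-<-trans aₗ≤c c<b₁₊ₗ

module _ {a b : List ℕ} where
  private
    S : Cell → Set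
    S = InSkew b a

  along-row-by : ∀ d {i j} → S (i , j) → S (i , d + j) → Path S (i , j) (i , d + j)
  along-row-by zero    _ _ = here
  along-row-by (suc d) {i} {j} s t = Path-snoc (along-row-by d s mid) t (inj₁ (refl , inj₁ refl))
    where
    mid : S (i , d + j)
    mid = ≤-trans (proj₁ s) (m≤n+m j d) , <-trans (n<1+n _) (proj₂ t)

  along-row : ∀ {i j j′} → S (i , j) → S (i , j′) → Path S (i , j) (i , j′)
  along-row {i} {j} {j′} s t with ≤-total j j′
  ... | inj₁ j≤j′ = subst (λ x → Path S (i , j) (i , x)) (m∸n+n≡m j≤j′)
                      (along-row-by (j′ ∸ j) s (subst (λ x → S (i , x)) (sym (m∸n+n≡m j≤j′)) t))
  ... | inj₂ j′≤j = Path-reverse t (subst (λ x → Path S (i , j′) (i , x)) (m∸n+n≡m j′≤j)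
                      (along-row-by (j ∸ j′) t (subst (λ x → S (i , x)) (sym (m∸n+n≡m j′≤j)) s)))

  module _ (da : Decreasing a) (db : Decreasing b) (linked : LinkedRows b a) where

    down-by : ∀ d {i j j′} → S (i , j) → S (d + i , j′) → Path S (i , j) (d + i , j′)
    down-by zero    s t = along-row s t
    down-by (suc d) {i} s t =
      Path-snoc (down-by d s corner) corner′ (inj₂ (refl , inj₁ refl)) ++ᵖ along-row corner′ t
      where
      aₗ<b₁₊ₗ : part a (d + i) < part b (suc (d + i))
      aₗ<b₁₊ₗ = linked (d + i) (≤-<-trans (proj₁ s) (proj₂ s)) (≤-<-trans (proj₁ t) (proj₂ t))
                  (m≤n+m i d) (n<1+n _)
      corner : S (d + i , part a (d + i))
      corner = ≤-refl , <-≤-trans aₗ<b₁₊ₗ (db (d + i))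
      corner′ : S (suc (d + i) , part a (d + i))
      corner′ = da (d + i) , aₗ<b₁₊ₗ

    LinkedRows⇒Connected : ConnectedSkew b a
    LinkedRows⇒Connected (i , j) (i′ , j′) s t with ≤-total i i′
    ... | inj₁ i≤i′ = subst (λ r → Path S (i , j) (r , j′)) (m∸n+n≡m i≤i′)
                        (down-by (i′ ∸ i) s (subst (λ r → S (r , j′)) (sym (m∸n+n≡m i≤i′)) t))
    ... | inj₂ i′≤i = Path-reverse t (subst (λ r → Path S (i′ , j′) (r , j)) (m∸n+n≡m i′≤i)
                        (down-by (i ∸ i′) t (subst (λ r → S (r , j)) (sym (m∸n+n≡m i′≤i)) s)))

RimHook⇒Ribbon : ∀ {a b n} → Decreasing a → Decreasing b → RimHook b a n → Ribbon b a × size b ≡ size a + n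
RimHook⇒Ribbon {a} {b} da db (a⊆b , size≡ , connected , no2x2) =
  (a⊆b , No2x2⇒Overlap≤1 {a} {b} da db no2x2 , Connected⇒LinkedRows {a} {b} connected) , size≡

Ribbon⇒RimHook : ∀ {a b n} → Decreasing a → Decreasing b → Ribbon b a → size b ≡ size a + n → RimHook b a n
Ribbon⇒RimHook {a} {b} da db (a⊆b , thin , linked) size≡ =
  a⊆b , size≡ , LinkedRows⇒Connected {a} {b} da db linked , Overlap≤1⇒No2x2 {a} {b} thin

⊆ᵖ-size-≡ : ∀ a b → a ⊆ᵖ b → size b ≡ size a → ∀ i → part a i ≡ part b i
⊆ᵖ-size-≡ a b a⊆b size≡ = parts≡
  where
  t⊆t : drop 1 a ⊆ᵖ drop 1 b
  t⊆t = ⊆ᵖ-drop a b a⊆b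
  sizes : part b 0 + size (drop 1 b) ≡ part a 0 + size (drop 1 a)
  sizes = trans (sym (size-drop b)) (trans size≡ (size-drop a))
  b₀≤a₀ : part b 0 ≤ part a 0
  b₀≤a₀ = +-cancelʳ-≤ (size (drop 1 b)) _ _
    (subst (_≤ part a 0 + size (drop 1 b)) (sym sizes) (+-monoʳ-≤ (part a 0) (size-mono (drop 1 a) (drop 1 b) t⊆t)))
  a₀≡b₀ : part a 0 ≡ part b 0
  a₀≡b₀ = ≤-antisym (a⊆b 0) b₀≤a₀
  parts≡ : ∀ i → part a i ≡ part b i
  parts≡ zero    = a₀≡b₀
  parts≡ (suc i) = begin
    part a (suc i)     ≡⟨ part-suc a i ⟩
    part (drop 1 a) i  ≡⟨ ⊆ᵖ-size-≡ (drop 1 a) (drop 1 b) t⊆t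
                            (+-cancelˡ-≡ (part a 0) _ _ (trans (cong (_+ _) a₀≡b₀) sizes)) i ⟩
    part (drop 1 b) i  ≡⟨ part-suc b i ⟨
    part b (suc i)     ∎
    where open ≡-Reasoning

rimHook-zero : ∀ {a b} → IsPartition a → IsPartition b → RimHook b a 0 → b ≡ a
rimHook-zero {a} {b} pa pb (a⊆b , size≡ , _) =
  sym (part-ext (proj₁ pa) (proj₁ pb) (⊆ᵖ-size-≡ a b a⊆b (trans size≡ (+-identityʳ (size a)))))

-- Adding a rim hook moves a bead

record Partition≤ (M : ℕ) (l : List ℕ) : Set where
  field
    positive   : Positive l
    decreasing : Decreasing l
    length≤    : length l ≤ M

  isPartition : IsPartition l
  isPartition = positive , Decreasing⇒Linked l decreasing

IsPartition⇒Partition≤ : ∀ {M l} → IsPartition l → length l ≤ M → Partition≤ M l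
IsPartition⇒Partition≤ pl l≤M = record
  { positive = proj₁ pl ; decreasing = IsPartition⇒Decreasing pl ; length≤ = l≤M }

Partition≤-drop : ∀ {M l} → Partition≤ (suc M) l → Partition≤ M (drop 1 l)
Partition≤-drop {l = l} pl = record
  { positive = Positive-drop positive ; decreasing = Decreasing-drop l decreasing
  ; length≤ = length-drop l length≤ }
  where open Partition≤ pl

Ribbon-drop : ∀ a b → Ribbon b a → Ribbon (drop 1 b) (drop 1 a)
Ribbon-drop a b (a⊆b , thin , linked) = ⊆ᵖ-drop a b a⊆b , thin′ , linked′
  where
  thin′ : Overlap≤1 (drop 1 b) (drop 1 a)
  thin′ i = subst₂ (λ u v → u ≤ suc v) (part-suc b (suc i)) (part-suc a i) (thin (suc i))
  linked′ : LinkedRows (drop 1 b) (drop 1 a)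
  linked′ {i} {j} l aᵢ<bᵢ aⱼ<bⱼ i≤l l<j =
    subst₂ _<_ (part-suc a l) (part-suc b (suc l))
      (linked (suc l) (subst₂ _<_ (sym (part-suc a i)) (sym (part-suc b i)) aᵢ<bᵢ)
                      (subst₂ _<_ (sym (part-suc a j)) (sym (part-suc b j)) aⱼ<bⱼ) (s≤s i≤l) (s≤s l<j))

∈-beads-drop-< : ∀ {M} l {x} → Decreasing l → x ∈ beads M (drop 1 l) → x < part l 0 + M
∈-beads-drop-< {M} l d = All-lookup (beads-< M (drop 1 l) (Decreasing-drop l d) (part-1≤part-0 l d))

∉-beads : ∀ {M} l {p} → Decreasing l → part l 0 ≤ p → p + M ∉ beads M l
∉-beads {M} l d l₀≤p p+M∈ = <-irrefl refl (<-≤-trans (∈-beads-< l d p+M∈) (+-monoˡ-≤ M l₀≤p))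

tail-size : ∀ a {s y} p M → s + y ≡ size (drop 1 a) + (part a 0 + M) → suc p + s + y ≡ size a + (p + suc M)
tail-size a {s} {y} p M s+y≡ = begin
  suc p + s + y                                   ≡⟨ +-assoc (suc p) s y ⟩
  suc p + (s + y)                                 ≡⟨ cong (suc p +_) s+y≡ ⟩
  suc p + (size (drop 1 a) + (part a 0 + M))      ≡⟨ rearrange p (size (drop 1 a)) (part a 0) M ⟩
  part a 0 + size (drop 1 a) + (p + suc M)        ≡⟨ cong (_+ (p + suc M)) (size-drop a) ⟨
  size a + (p + suc M)                            ∎
  where
  open ≡-Reasoning
  rearrange : ∀ p t a₀ M → suc p + (t + (a₀ + M)) ≡ a₀ + t + (p + suc M)
  rearrange = solve-∀

+-cancel-⇔ : ∀ {x y p q} → x + y ≡ p + q → x ≡ p ⇔ y ≡ q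
+-cancel-⇔ {x} {y} {p} {q} e =
  mk⇔ (λ { refl → +-cancelˡ-≡ x y q e }) (λ { refl → +-cancelʳ-≡ y x p e })

hook-size : ∀ a b y n M → size (drop 1 b) + y ≡ size (drop 1 a) + (part a 0 + M) →
            size b ≡ size a + n ⇔ y + n ≡ part b 0 + M
hook-size a b y n M s+y≡ = +-cancel-⇔ (begin
  size b + (y + n)                             ≡⟨ cong (_+ (y + n)) (size-drop b) ⟩
  b₀ + s + (y + n)                             ≡⟨ regroup b₀ s y n ⟩
  b₀ + n + (s + y)                             ≡⟨ cong (b₀ + n +_) s+y≡ ⟩
  b₀ + n + (t + (a₀ + M))                      ≡⟨ regroup′ a₀ b₀ t n M ⟩
  a₀ + t + n + (b₀ + M)                        ≡⟨ cong (λ x → x + n + (b₀ + M)) (size-drop a) ⟨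
  size a + n + (b₀ + M)                        ∎)
  where
  open ≡-Reasoning
  a₀ b₀ s t : ℕ
  a₀ = part a 0
  b₀ = part b 0
  s = size (drop 1 b)
  t = size (drop 1 a)
  regroup : ∀ b₀ s y n → b₀ + s + (y + n) ≡ b₀ + n + (s + y)
  regroup = solve-∀
  regroup′ : ∀ a₀ b₀ t n M → b₀ + n + (t + (a₀ + M)) ≡ a₀ + t + n + (b₀ + M)
  regroup′ = solve-∀

Overlap≤1-head : ∀ a b → Overlap≤1 b a → part (drop 1 b) 0 ≤ suc (part a 0)
Overlap≤1-head a b thin = subst (_≤ suc (part a 0)) (part-suc b 0) (thin 0)

LinkedRows-head : ∀ a b → LinkedRows b a → part a 0 < part b 0 →
                  ∀ j → part (drop 1 a) j < part (drop 1 b) j → part a 0 < part (drop 1 b) 0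
LinkedRows-head a b linked a₀<b₀ j aⱼ<bⱼ = subst (part a 0 <_) (part-suc b 0)
  (linked 0 a₀<b₀ (subst₂ _<_ (sym (part-suc a j)) (sym (part-suc b j)) aⱼ<bⱼ) z≤n (s≤s z≤n))

size-drop-≡ : ∀ a b {n} → part a 0 ≡ part b 0 → size b ≡ size a + n → size (drop 1 b) ≡ size (drop 1 a) + n
size-drop-≡ a b {n} a₀≡b₀ size≡ = +-cancelˡ-≡ (part a 0) _ _ (begin
  part a 0 + size (drop 1 b)         ≡⟨ cong (_+ size (drop 1 b)) a₀≡b₀ ⟩
  part b 0 + size (drop 1 b)         ≡⟨ size-drop b ⟨
  size b                             ≡⟨ size≡ ⟩
  size a + n                         ≡⟨ cong (_+ n) (size-drop a) ⟩
  part a 0 + size (drop 1 a) + n     ≡⟨ +-assoc (part a 0) _ n ⟩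
  part a 0 + (size (drop 1 a) + n)   ∎)
  where open ≡-Reasoning

tail⇒removed : ∀ M p {a b} → Partition≤ M a → Partition≤ M b → Ribbon b a →
               part b 0 ≤ suc p → part a 0 ≤ p → (∀ j → part a j < part b j → p < part b 0) →
               ∃ λ y → y ∈ p + M ∷ beads M a × Removed y (p + M ∷ beads M a) (beads M b)
                       × size b + y ≡ size a + (p + M)
tail⇒removed zero p {[]} {[]} _ _ _ _ _ _ = p + 0 , here refl , removed-head (λ ()) , refl
tail⇒removed zero p {_ ∷ _} record { length≤ = () } _ _ _ _ _
tail⇒removed zero p {[]} {_ ∷ _} _ record { length≤ = () } _ _ _ _
tail⇒removed (suc M) p {a} {b} pa pb ribbon@(a⊆b , thin , linked) b₀≤1+p a₀≤p meets
  with m≤n⇒m<n∨m≡n (a⊆b 0)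
... | inj₂ a₀≡b₀ =
  p + suc M , here refl ,
  subst (λ l → Removed (p + suc M) (p + suc M ∷ beads (suc M) a) (beads (suc M) l)) a≡b
        (removed-head (∉-beads a (Partition≤.decreasing pa) a₀≤p)) ,
  cong (λ l → size l + (p + suc M)) (sym a≡b)
  where
  parts≡ : ∀ i → part a i ≡ part b i
  parts≡ zero = a₀≡b₀
  parts≡ (suc i) with m≤n⇒m<n∨m≡n (a⊆b (suc i))
  ... | inj₁ aᵢ<bᵢ = ⊥-elim (<-irrefl refl
                       (<-≤-trans (meets (suc i) aᵢ<bᵢ) (subst (_≤ p) a₀≡b₀ a₀≤p)))
  ... | inj₂ aᵢ≡bᵢ = aᵢ≡bᵢ
  a≡b : a ≡ b
  a≡b = part-ext (Partition≤.positive pa) (Partition≤.positive pb) parts≡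
... | inj₁ a₀<b₀
  with y , y∈ , removed , size≡ ← tail⇒removed M (part a 0) (Partition≤-drop pa) (Partition≤-drop pb)
         (Ribbon-drop a b ribbon) (Overlap≤1-head a b thin)
         (part-1≤part-0 a (Partition≤.decreasing pa)) (LinkedRows-head a b linked a₀<b₀)
  = y , there y∈ , removed′ , size≡′
  where
  b₀≡1+p : part b 0 ≡ suc p
  b₀≡1+p = ≤-antisym b₀≤1+p (meets 0 a₀<b₀)
  top≡ : part b 0 + M ≡ p + suc M
  top≡ = trans (cong (_+ M) b₀≡1+p) (sym (+-suc p M))
  removed′ : Removed y (p + suc M ∷ beads (suc M) a) (part b 0 + M ∷ beads M (drop 1 b))
  removed′ = subst (λ h → Removed y (h ∷ beads (suc M) a) (part b 0 + M ∷ beads M (drop 1 b))) top≡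
    (removed-∷ (λ top≡y → ∉-beads a (Partition≤.decreasing pa) a₀≤p
                             (subst (_∈ beads (suc M) a) (trans (sym top≡y) top≡) y∈)) removed)
  size≡′ : size b + y ≡ size a + (p + suc M)
  size≡′ = begin
    size b + y                         ≡⟨ cong (_+ y) (size-drop b) ⟩
    part b 0 + size (drop 1 b) + y     ≡⟨ cong (λ b₀ → b₀ + size (drop 1 b) + y) b₀≡1+p ⟩
    suc p + size (drop 1 b) + y        ≡⟨ tail-size a p M size≡ ⟩
    size a + (p + suc M)               ∎
    where open ≡-Reasoning

ribbon⇒beadMove : ∀ M n {a b} → Partition≤ M a → Partition≤ M b → Ribbon b a →
                  size b ≡ size a + n → 1 ≤ n →
                  ∃ λ y → y ∈ beads M a × y + n ∉ beads M a × Moved y (y + n) (beads M a) (beads M b)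
ribbon⇒beadMove zero (suc n) {[]} {[]} _ _ _ () _
ribbon⇒beadMove zero n {_ ∷ _} record { length≤ = () } _ _ _ _
ribbon⇒beadMove zero n {[]} {_ ∷ _} _ record { length≤ = () } _ _ _
ribbon⇒beadMove (suc M) n {a} {b} pa pb ribbon@(a⊆b , thin , linked) size≡ 1≤n
  with m≤n⇒m<n∨m≡n (a⊆b 0)
... | inj₂ a₀≡b₀
  with y , y∈ , y+n∉ , moved ← ribbon⇒beadMove M n (Partition≤-drop pa) (Partition≤-drop pb)
         (Ribbon-drop a b ribbon) (size-drop-≡ a b a₀≡b₀ size≡) 1≤n
  = y , there y∈ , y+n∉′ , moved′
  where
  y<top : y < part a 0 + M
  y<top = ∈-beads-drop-< a (Partition≤.decreasing pa) y∈
  y+n∉′ : y + n ∉ beads (suc M) a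
  y+n∉′ (here y+n≡top) = <-irrefl y+n≡top
    (subst (λ b₀ → y + n < b₀ + M) (sym a₀≡b₀)
      (∈-beads-drop-< b (Partition≤.decreasing pb) (moved-target moved)))
  y+n∉′ (there y+n∈) = y+n∉ y+n∈
  moved′ : Moved y (y + n) (beads (suc M) a) (beads (suc M) b)
  moved′ = subst (λ h → Moved y (y + n) (beads (suc M) a) (h ∷ beads M (drop 1 b))) (cong (_+ M) a₀≡b₀)
    (moved-∷ (λ top≡y → <-irrefl (sym top≡y) y<top) moved)
... | inj₁ a₀<b₀
  with y , y∈ , removed , size≡′ ← tail⇒removed M (part a 0) (Partition≤-drop pa) (Partition≤-drop pb)
         (Ribbon-drop a b ribbon) (Overlap≤1-head a b thin)
         (part-1≤part-0 a (Partition≤.decreasing pa)) (LinkedRows-head a b linked a₀<b₀)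
  = y , y∈ , y+n∉ ,
    subst (λ z → Moved y z (beads (suc M) a) (beads (suc M) b)) (sym y+n≡top) (removed⇒moved removed)
  where
  y+n≡top : y + n ≡ part b 0 + M
  y+n≡top = to (hook-size a b y n M size≡′) size≡
  y+n∉ : y + n ∉ beads (suc M) a
  y+n∉ y+n∈ = <-irrefl y+n≡top (<-≤-trans (∈-beads-< a (Partition≤.decreasing pa) y+n∈)
    (subst (_≤ part b 0 + M) (sym (+-suc (part a 0) M)) (+-monoˡ-≤ M a₀<b₀)))

-- Moving a bead adds a rim hook

-- The rows of a rim hook below a row of inner length p that it occupies. Each of them takes
-- over the bead of the row above (bᵢ₊₁ = aᵢ + 1), so their beads are those of a together
-- with p + M, the bead of the row above, minus the bead y of the last row of the hook.
record HookTail (M p : ℕ) (a : List ℕ) (y : ℕ) : Set where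
  field
    shape       : List ℕ
    partition≤  : Partition≤ M shape
    ⊆shape      : a ⊆ᵖ shape
    thin        : Overlap≤1 shape a
    linkedToTop : LinkedToTop shape a
    head≤       : part shape 0 ≤ suc p
    meetsAbove  : ∀ j → part a j < part shape j → p < part shape 0
    size≡       : size shape + y ≡ size a + (p + M)
    removed     : Removed y (p + M ∷ beads M a) (beads M shape)

HookTail-cons : ∀ {M y} a x → part a 0 < x → (R : HookTail M (part a 0) (drop 1 a) y) →
                let b = x ∷ HookTail.shape R in
                Partition≤ (suc M) b × a ⊆ᵖ b × Overlap≤1 b a × LinkedToTop b a
HookTail-cons a x a₀<x R =
  record { positive = ≤-trans (s≤s z≤n) a₀<x ∷ positive ; decreasing = decreasing′
         ; length≤ = s≤s length≤ }
  , ⊆shape′ , thin′ , linkedToTop′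
  where
  open HookTail R
  open Partition≤ partition≤
  b : List ℕ
  b = x ∷ shape
  decreasing′ : Decreasing b
  decreasing′ zero    = ≤-trans head≤ a₀<x
  decreasing′ (suc i) = decreasing i
  ⊆shape′ : a ⊆ᵖ b
  ⊆shape′ zero    = <⇒≤ a₀<x
  ⊆shape′ (suc i) = subst (_≤ part shape i) (sym (part-suc a i)) (⊆shape i)
  thin′ : Overlap≤1 b a
  thin′ zero    = head≤
  thin′ (suc i) = subst (λ v → part shape (suc i) ≤ suc v) (sym (part-suc a i)) (thin i)
  linkedToTop′ : LinkedToTop b a
  linkedToTop′ {zero}  _       _     ()
  linkedToTop′ {suc j} zero    aⱼ<bⱼ _ = meetsAbove j (subst (_< part shape j) (part-suc a j) aⱼ<bⱼ)
  linkedToTop′ {suc j} (suc l) aⱼ<bⱼ (s≤s l<j) = subst (_< part shape (suc l)) (sym (part-suc a l))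
    (linkedToTop l (subst (_< part shape j) (part-suc a j) aⱼ<bⱼ) l<j)

removed⇒tail : ∀ M p {a y} → Partition≤ M a → part a 0 ≤ p → y ∈ p + M ∷ beads M a → HookTail M p a y
removed⇒tail M p {a} pa a₀≤p (here refl) = record
  { shape = a ; partition≤ = pa ; ⊆shape = λ _ → ≤-refl
  ; thin = λ i → ≤-trans (decreasing i) (n≤1+n _)
  ; linkedToTop = λ _ aⱼ<aⱼ _ → ⊥-elim (<-irrefl refl aⱼ<aⱼ)
  ; head≤ = ≤-trans a₀≤p (n≤1+n p)
  ; meetsAbove = λ _ aⱼ<aⱼ → ⊥-elim (<-irrefl refl aⱼ<aⱼ)
  ; size≡ = refl
  ; removed = removed-head (∉-beads a decreasing a₀≤p) }
  where open Partition≤ pa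
removed⇒tail zero    p pa a₀≤p (there ())
removed⇒tail (suc M) p {a} {y} pa a₀≤p (there y∈) =
  let partition≤ , ⊆shape , thin , linkedToTop = HookTail-cons a (suc p) (s≤s a₀≤p) R
  in record
    { shape = suc p ∷ R.shape
    ; partition≤ = partition≤ ; ⊆shape = ⊆shape ; thin = thin ; linkedToTop = linkedToTop
    ; head≤ = ≤-refl
    ; meetsAbove = λ _ _ → ≤-refl
    ; size≡ = tail-size a p M R.size≡
    ; removed = subst (λ h → Removed y (p + suc M ∷ beads (suc M) a) (h ∷ beads M R.shape)) (+-suc p M)
                  (removed-∷ (λ top≡y → ∉-beads a (Partition≤.decreasing pa) a₀≤p
                                          (subst (_∈ beads (suc M) a) (sym top≡y) y∈))
                             R.removed) }
  where
  R : HookTail M (part a 0) (drop 1 a) y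
  R = removed⇒tail M (part a 0) (Partition≤-drop pa) (part-1≤part-0 a (Partition≤.decreasing pa)) y∈
  module R = HookTail R

LinkedToTop⇒LinkedRows : ∀ {a b} → LinkedToTop b a → LinkedRows b a
LinkedToTop⇒LinkedRows linked l _ aⱼ<bⱼ _ l<j = linked l aⱼ<bⱼ l<j

record HookAddition (M n : ℕ) (a : List ℕ) (y : ℕ) : Set where
  field
    shape      : List ℕ
    partition≤ : Partition≤ M shape
    ribbon     : Ribbon shape a
    size≡      : size shape ≡ size a + n
    moved      : Moved y (y + n) (beads M a) (beads M shape)

  rimHook : Decreasing a → RimHook shape a n
  rimHook da = Ribbon⇒RimHook {a} {shape} da (Partition≤.decreasing partition≤) ribbon size≡

hookAddition-inTopRow : ∀ M n {a y} → Partition≤ (suc M) a → y ∈ beads (suc M) a → part a 0 + M < y + n →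
                        HookAddition (suc M) n a y
hookAddition-inTopRow M n {a} {y} pa y∈ top<y+n =
  let partition≤ , a⊆b , thin , linked = HookTail-cons a b₀ a₀<b₀ R
  in record
    { shape = b₀ ∷ R.shape
    ; partition≤ = partition≤
    ; ribbon = a⊆b , thin , LinkedToTop⇒LinkedRows {a} {b₀ ∷ R.shape} linked
    ; size≡ = from (hook-size a (b₀ ∷ R.shape) y n M R.size≡) (sym b₀+M≡y+n)
    ; moved = subst (λ z → Moved y z (beads (suc M) a) (b₀ + M ∷ beads M R.shape)) b₀+M≡y+n
                (removed⇒moved R.removed) }
  where
  R : HookTail M (part a 0) (drop 1 a) y
  R = removed⇒tail M (part a 0) (Partition≤-drop pa) (part-1≤part-0 a (Partition≤.decreasing pa)) y∈
  module R = HookTail R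
  b₀ : ℕ
  b₀ = y + n ∸ M
  b₀+M≡y+n : b₀ + M ≡ y + n
  b₀+M≡y+n = m∸n+n≡m (≤-trans (m≤n+m M (part a 0)) (<⇒≤ top<y+n))
  a₀<b₀ : part a 0 < b₀
  a₀<b₀ = +-cancelʳ-< M _ _ (subst (part a 0 + M <_) (sym b₀+M≡y+n) top<y+n)

beadMove⇒hookAddition : ∀ M n {a y} → Partition≤ M a → y ∈ beads M a → y + n ∉ beads M a →
                        HookAddition M n a y

hookAddition-belowTopRow : ∀ M n {a y} → Partition≤ (suc M) a → y ∈ beads (suc M) a →
                           y + n ∉ beads (suc M) a → y + n < part a 0 + M → HookAddition (suc M) n a y
hookAddition-belowTopRow M n {[]} _ _ y+n∉ y+n<M = ⊥-elim (y+n∉ (there (∈-beads-[] y+n<M)))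
hookAddition-belowTopRow zero n {x ∷ a} _ (here y≡top) _ y+n<top =
  ⊥-elim (<-irrefl y≡top (≤-<-trans (m≤m+n _ n) y+n<top))
hookAddition-belowTopRow M@(suc M′) n {x ∷ a} {y} pxa y∈ y+n∉ y+n<top = record
  { shape = x ∷ R.shape
  ; partition≤ = record
      { positive = All.head (Partition≤.positive pxa) ∷ positive
      ; decreasing = decreasing′ ; length≤ = s≤s length≤ }
  ; ribbon = a⊆b , thin , linked
  ; size≡ = trans (cong (x +_) R.size≡) (sym (+-assoc x _ n))
  ; moved = moved-∷ (λ top≡y → y≢top (sym top≡y)) R.moved }
  where
  y≢top : y ≢ x + M
  y≢top y≡top = <-irrefl y≡top (≤-<-trans (m≤m+n y n) y+n<top)
  R : HookAddition M n a y
  R = beadMove⇒hookAddition M n {a} (Partition≤-drop pxa) (Any-tail y≢top y∈) (y+n∉ ∘ there)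
  module R = HookAddition R
  open Partition≤ R.partition≤
  beads<top : ∀ {z} → z ∈ beads M R.shape → z < x + M
  beads<top z∈ with to R.moved z∈
  ... | inj₁ refl           = y+n<top
  ... | inj₂ (z∈a , _) = <-≤-trans (∈-beads-< a (Decreasing-drop (x ∷ a) (Partition≤.decreasing pxa)) z∈a)
                                   (+-monoˡ-≤ M (Partition≤.decreasing pxa 0))
  decreasing′ : Decreasing (x ∷ R.shape)
  decreasing′ zero = +-cancelʳ-≤ M′ _ _ (≤-pred (subst (part R.shape 0 + M′ <_) (+-suc x M′) (beads<top (here refl))))
  decreasing′ (suc i) = decreasing i
  a⊆b : (x ∷ a) ⊆ᵖ (x ∷ R.shape)
  a⊆b zero    = ≤-refl
  a⊆b (suc i) = proj₁ R.ribbon i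
  thin : Overlap≤1 (x ∷ R.shape) (x ∷ a)
  thin zero    = ≤-trans (decreasing′ zero) (n≤1+n x)
  thin (suc i) = proj₁ (proj₂ R.ribbon) i
  linked : LinkedRows (x ∷ R.shape) (x ∷ a)
  linked {zero}  _       x<x _     _   _         = ⊥-elim (<-irrefl refl x<x)
  linked {suc i} {zero}  _       _ _ _   ()
  linked {suc i} {suc j} zero    _ _ ()  _
  linked {suc i} {suc j} (suc l) aᵢ<bᵢ aⱼ<bⱼ (s≤s i≤l) (s≤s l<j) =
    proj₂ (proj₂ R.ribbon) l aᵢ<bᵢ aⱼ<bⱼ i≤l l<j

beadMove⇒hookAddition zero    _ _ () _
beadMove⇒hookAddition (suc M) n {a} {y} pa y∈ y+n∉ = case <-cmp (y + n) (part a 0 + M) of λ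
  { (tri≈ _ y+n≡top _) → ⊥-elim (y+n∉ (here y+n≡top))
  ; (tri> _ _ top<y+n) → hookAddition-inTopRow M n pa y∈ top<y+n
  ; (tri< y+n<top _ _) → hookAddition-belowTopRow M n pa y∈ y+n∉ y+n<top }

-- Splitting rim hooks

beads-moved-unique : ∀ M {y z xs d b} → Partition≤ M d → Partition≤ M b →
                     Moved y z xs (beads M d) → Moved y z xs (beads M b) → d ≡ b
beads-moved-unique M pd pb moved-d moved-b =
  beads-⊆-antisym M (Partition≤.isPartition pd) (Partition≤.isPartition pb)
    (Partition≤.length≤ pd) (Partition≤.length≤ pb) (moved-⊆ moved-d moved-b) (moved-⊆ moved-b moved-d)

SplitRimHook : List ℕ → List ℕ → ℕ → ℕ → Set
SplitRimHook b a n₁ n₂ =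
  ∃ λ c → IsPartition c × (RimHook c a n₁ × RimHook b c n₂ ⊎ RimHook c a n₂ × RimHook b c n₁)

beadMove-split : ∀ M n₁ n₂ {a b y} → Partition≤ M a → Partition≤ M b →
                 y ∈ beads M a → y + n₁ + n₂ ∉ beads M a → Moved y (y + n₁ + n₂) (beads M a) (beads M b) →
                 1 ≤ n₁ → 1 ≤ n₂ →
                 SplitRimHook b a n₁ n₂
beadMove-split M n₁ n₂ {a} {b} {y} pa pb y∈ w∉ moved 1≤n₁ 1≤n₂ with y + n₁ ∈? beads M a
... | no z∉ = H₁.shape , Partition≤.isPartition H₁.partition≤ ,
              inj₁ (H₁.rimHook (Partition≤.decreasing pa) ,
                    subst (λ d → RimHook d H₁.shape n₂) d≡b (H₂.rimHook (Partition≤.decreasing H₁.partition≤)))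
  where
  H₁ : HookAddition M n₁ a y
  H₁ = beadMove⇒hookAddition M n₁ pa y∈ z∉
  module H₁ = HookAddition H₁
  H₂ : HookAddition M n₂ H₁.shape (y + n₁)
  H₂ = beadMove⇒hookAddition M n₂ H₁.partition≤ (moved-target H₁.moved)
         (moved-∉ H₁.moved w∉ (λ e → <-irrefl (sym e) (m<m+n (y + n₁) 1≤n₂)))
  module H₂ = HookAddition H₂
  d≡b : H₂.shape ≡ b
  d≡b = beads-moved-unique M H₂.partition≤ pb (moved-trans z∉ H₁.moved H₂.moved) moved
... | yes z∈ = H₁.shape , Partition≤.isPartition H₁.partition≤ ,
               inj₂ (H₁.rimHook (Partition≤.decreasing pa) ,
                     subst (λ d → RimHook d H₁.shape n₁) d≡b (H₂.rimHook (Partition≤.decreasing H₁.partition≤)))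
  where
  y<z : y < y + n₁
  y<z = m<m+n y 1≤n₁
  z<w : y + n₁ < y + n₁ + n₂
  z<w = m<m+n (y + n₁) 1≤n₂
  H₁ : HookAddition M n₂ a (y + n₁)
  H₁ = beadMove⇒hookAddition M n₂ pa z∈ w∉
  module H₁ = HookAddition H₁
  H₂ : HookAddition M n₁ H₁.shape y
  H₂ = beadMove⇒hookAddition M n₁ H₁.partition≤ (moved-∈ H₁.moved y∈ (<⇒≢ y<z))
         (moved-source (<⇒≢ z<w) H₁.moved)
  module H₂ = HookAddition H₂
  d≡b : H₂.shape ≡ b
  d≡b = beads-moved-unique M H₂.partition≤ pb
          (moved-swap z∈ (≢-sym (<⇒≢ y<z)) (≢-sym (<⇒≢ (<-trans y<z z<w))) H₁.moved H₂.moved) moved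

rimHook-split : ∀ n₁ n₂ {a b} → IsPartition a → IsPartition b → RimHook b a (n₁ + n₂) → 1 ≤ n₁ → 1 ≤ n₂ →
                SplitRimHook b a n₁ n₂
rimHook-split n₁ n₂ {a} {b} pa pb h 1≤n₁ 1≤n₂ =
  let y , y∈ , w∉ , moved = ribbon⇒beadMove M (n₁ + n₂) Pa Pb ribbon size≡ (≤-trans 1≤n₁ (m≤m+n n₁ n₂))
  in beadMove-split M n₁ n₂ Pa Pb y∈ (subst (_∉ beads M a) (sym (+-assoc y n₁ n₂)) w∉)
       (subst (λ w → Moved y w (beads M a) (beads M b)) (sym (+-assoc y n₁ n₂)) moved) 1≤n₁ 1≤n₂
  where
  M : ℕ
  M = size b
  ribbon : Ribbon b a
  ribbon = proj₁ (RimHook⇒Ribbon {a} {b} (IsPartition⇒Decreasing pa) (IsPartition⇒Decreasing pb) h)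
  size≡ : size b ≡ size a + (n₁ + n₂)
  size≡ = proj₂ (RimHook⇒Ribbon {a} {b} (IsPartition⇒Decreasing pa) (IsPartition⇒Decreasing pb) h)
  Pa : Partition≤ M a
  Pa = IsPartition⇒Partition≤ pa
         (≤-trans (length≤size (proj₁ pa)) (subst (size a ≤_) (sym size≡) (m≤m+n _ _)))
  Pb : Partition≤ M b
  Pb = IsPartition⇒Partition≤ pb (length≤size (proj₁ pb))

-- Chains of rim hooks

_++ᶜ_ : ∀ {a b c ν ν′} → Chain a ν b → Chain b ν′ c → Chain a (ν ++ ν′) c
done          ++ᶜ q = q
add pb h p    ++ᶜ q = add pb h (p ++ᶜ q)

replicate-+ : ∀ {A : Set} m n (x : A) → replicate (m + n) x ≡ replicate m x ++ replicate n x
replicate-+ zero    n x = refl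
replicate-+ (suc m) n x = cong (x ∷_) (replicate-+ m n x)

rimHook⇒chain : ∀ k m {a b} → 1 ≤ k → IsPartition a → IsPartition b → RimHook b a (k * m) →
                Chain a (replicate m k) b
rimHook⇒chain k zero {a} {b} _ pa pb h =
  subst (Chain a []) (sym (rimHook-zero pa pb (subst (RimHook b a) (*-zeroʳ k) h))) done
rimHook⇒chain k (suc zero) {a} {b} _ _ pb h = add pb (subst (RimHook b a) (*-identityʳ k) h) done
rimHook⇒chain k (suc (suc m)) {a} {b} 1≤k pa pb h =
  -- Eliminating with [_,_]′ rather than with `with` keeps the recursive calls visibly on suc m.
  let c , pc , split = rimHook-split k (k * suc m) pa pb (subst (RimHook b a) (*-suc k (suc m)) h) 1≤k
                         (≤-trans 1≤k (m≤m*n k (suc m)))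
  in [ (λ hooks → add pc (proj₁ hooks) (rimHook⇒chain k (suc m) 1≤k pc pb (proj₂ hooks)))
     , (λ hooks → subst (λ ν → Chain a ν b) replicate-snoc
                    (rimHook⇒chain k (suc m) 1≤k pa pc (proj₁ hooks) ++ᶜ add pb (proj₂ hooks) done))
     ]′ split
  where
  replicate-snoc : replicate (suc m) k ++ k ∷ [] ≡ replicate (suc (suc m)) k
  replicate-snoc = trans (sym (replicate-+ (suc m) 1 k)) (cong (λ t → replicate t k) (+-comm (suc m) 1))

scaled-chain⇒chain : ∀ k μ {a b} → 1 ≤ k → IsPartition a → Chain a (scale k μ) b →
                     Chain a (replicate (sum μ) k) b
scaled-chain⇒chain k []      _   _  done = done
scaled-chain⇒chain k (m ∷ μ) {a} {b} 1≤k pa (add pc h rest) =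
  subst (λ ν → Chain a ν b) (sym (replicate-+ m (sum μ) k))
        (rimHook⇒chain k m 1≤k pa pc h ++ᶜ scaled-chain⇒chain k μ 1≤k pc rest)

corollary4p7 : (k p : ℕ) → 2 ≤ k → (λ′ : List ℕ) → IsPartition λ′ →
               size λ′ ≡ k * p → (μ : List ℕ) → sum μ ≡ p →
               RHT λ′ (scale k μ) → RHT λ′ (replicate p k)
corollary4p7 k p 2≤k λ′ _ _ μ sum≡p rht =
  subst (λ q → RHT λ′ (replicate q k)) sum≡p (scaled-chain⇒chain k μ (<⇒≤ 2≤k) ([] , []) rht)
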